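{- Let $q$ be square-free, $s=2^{\omega(q)}/\sigma_{ -1}(q)$, and fix $\alpha>0$. Then as $s\to\infty$, $$\#\{d\mid q: d<s^\alpha\}=O(s^\epsilon)$$ for every $\epsilon>0$.
   Context: $\omega(q)$ is the number of prime factors of $q$ and $\sigma_{ -1}(q)=\sum_{d\mid q}d^{ -1}=\prod_{p\mid q}(1+1/p)$ for square-free $q$. The implied constant depends on $\alpha$ and $\epsilon$ only.
   Formalization: The parameters α and ε range only over the positive rationals. -}

module Defs where

open import Data.Nat using (ℕ; suc; _+_; _*_; _^_; _<_; _<?_)
open import Data.Nat.Divisibility using (_∣_; _∣?_)
open import Data.Nat.Primality using (prime?)
open import Data.List using (List; filter; map; upTo; length)
open import Data.Nat.ListAction using (sum)
open import Relation.Nullary.Decidable using (_×-dec_)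
open import Relation.Binary.PropositionalEquality using (_≡_)

-- q is square-free (in particular q ≠ 0, since 2*2 ∣ 0)
SquareFree : ℕ → Set
SquareFree q = ∀ p → p * p ∣ q → p ≡ 1

divisors : ℕ → List ℕ
divisors q = filter (_∣? q) (map suc (upTo q))

ω : ℕ → ℕ
ω q = length (filter (λ p → prime? p ×-dec p ∣? q) (upTo (suc q)))

-- σ(q) = Σ_{d ∣ q} d ; note σ_{-1}(q) = σ(q) / q, hence
-- s = 2^ω(q) / σ_{-1}(q) = (2^ω(q) * q) / σ(q).
σ : ℕ → ℕ
σ q = sum (divisors q)

sNum : ℕ → ℕ
sNum q = 2 ^ ω q * q

sDen : ℕ → ℕ
sDen q = σ q

-- #{ d ∣ q : d < s^(a/b) }, using  d < s^(a/b)  ⇔  d^b < s^a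
--   ⇔  d^b * sDen^a < sNum^a
smallDivisorCount : ℕ → ℕ → ℕ → ℕ
smallDivisorCount a b q =
  length (filter (λ d → d ^ b * sDen q ^ a <? sNum q ^ a) (divisors q))

-- A divisor of a square-free q is the product of a subset of the ω = ω(q) primes dividing q,
-- and s = 2^ω q / σ(q) = ∏_{p ∣ q} 2p / (p + 1) lies between (4/3)^ω and 2^ω, so with
-- A = a + 1 and B = b + 1, d < s^(A/B) forces d^B < (2^A)^ω. Such subset products are counted
-- with Rankin's trick, charging a weight (1 + 1/c) per unit of the exponent budget ω: each of the
-- fewer than M = (2^A)^(c²) primes below M at most doubles the count, while a prime p ≥ M uses up
-- c²B units of the budget and so contributes only a factor 1 + (c/(1 + c))^(c²B) ≤ 1 + 1/c.
-- Hence the count N is at most 2^M ((1 + 1/c)²)^ω, and for F = f + 1 and c = 8F this gives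
-- N^F ≤ 2^(MF) (4/3)^ω ≤ 2^(MF) s ≤ 2^(MF) s^(e + 1).

module Submission where

open import Defs
open import Data.Nat using (ℕ; zero; suc; _+_; _*_; _^_; _≤_; _<_; z≤n; s≤s; NonZero; nonTrivial⇒n>1)
open import Data.Nat.Properties
open import Data.Nat.Divisibility using (_∣_; _∣?_; _∣0; divides; ∣-trans; ∣-refl; *-monoˡ-∣; *-monoʳ-∣; ∣⇒≤; m∣m*n; 1∣_)
open import Data.Nat.Primality using (Prime; prime?; ¬prime[1]; euclidsLemma; prime⇒irreducible; prime⇒nonZero; prime⇒nonTrivial)
open import Data.Nat.Primality.Factorisation using (factorise)
open import Data.Nat.ListAction using (sum; product)
open import Data.Nat.ListAction.Properties using (sum-↭; sum-++)
open import Data.Nat.Tactic.RingSolver using (solve-∀)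
open import Data.List using (List; []; _∷_; _++_; [_]; map; filter; length; upTo)
open import Data.List.Properties using (filter-++; length-++; length-filter; length-upTo; map-id; filter-none; filter-accept; filter-reject)
open import Data.List.Membership.Propositional using (_∈_)
open import Data.List.Membership.Propositional.Properties using (∈-∃++; ∈-filter⁺; ∈-filter⁻; ∈-map⁺; ∈-map⁻; ∈-upTo⁺; ∈-++⁺ˡ; ∈-++⁺ʳ)
open import Data.List.Relation.Binary.Subset.Propositional using (_⊆_)
open import Data.List.Relation.Binary.Permutation.Propositional.Properties using (shift; map⁺; ∈-resp-↭)
open import Data.List.Relation.Unary.All as All using (All; []; _∷_)
import Data.List.Relation.Unary.All.Properties as All
open import Data.List.Relation.Unary.AllPairs using (_∷_)
open import Data.List.Relation.Unary.Any using (here; there)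
open import Data.List.Relation.Unary.Any.Properties using (¬Any[])
open import Data.List.Relation.Unary.Unique.Propositional using (Unique)
import Data.List.Relation.Unary.Unique.Propositional.Properties as Unique
open import Data.Product using (∃; _,_; _×_; proj₁; proj₂)
open import Data.Sum using (inj₁; inj₂)
open import Function using (id; _∘_)
open import Relation.Binary.PropositionalEquality using (_≡_; _≢_; refl; sym; trans; cong; subst; subst₂; module ≡-Reasoning)
open import Relation.Nullary using (¬_; contradiction; yes; no)
open import Relation.Nullary.Decidable using (_×-dec_)
open import Relation.Unary using (Pred; Decidable)

module _ {ℓ} {A : Set ℓ} where

  sum-map-mono-⊆ : ∀ (f : A → ℕ) {xs ys} → Unique xs → xs ⊆ ys → sum (map f xs) ≤ sum (map f ys)
  sum-map-mono-⊆ f {[]} _ _ = z≤n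
  sum-map-mono-⊆ f {x ∷ xs} {ys} (x∉xs ∷ xs!) xs⊆ys with as , bs , refl ← ∈-∃++ (xs⊆ys (here refl)) = begin
    f x + sum (map f xs)          ≤⟨ +-monoʳ-≤ (f x) (sum-map-mono-⊆ f xs! xs⊆as++bs) ⟩
    f x + sum (map f (as ++ bs))  ≡⟨ sum-↭ (map⁺ f (shift x as bs)) ⟨
    sum (map f (as ++ x ∷ bs))    ∎
    where
    open ≤-Reasoning
    xs⊆as++bs : xs ⊆ as ++ bs
    xs⊆as++bs z∈xs with ∈-resp-↭ (shift x as bs) (xs⊆ys (there z∈xs))
    ... | here refl  = contradiction refl (All.lookup x∉xs z∈xs)
    ... | there z∈   = z∈

  length-mono-⊆ : ∀ {xs ys : List A} → Unique xs → xs ⊆ ys → length xs ≤ length ys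
  length-mono-⊆ {xs = xs} {ys} xs! xs⊆ys = begin
    length xs                ≡⟨ length≡sum-ones xs ⟩
    sum (map (λ _ → 1) xs)   ≤⟨ sum-map-mono-⊆ (λ _ → 1) xs! xs⊆ys ⟩
    sum (map (λ _ → 1) ys)   ≡⟨ length≡sum-ones ys ⟨
    length ys                ∎
    where
    open ≤-Reasoning
    length≡sum-ones : (zs : List _) → length zs ≡ sum (map (λ _ → 1) zs)
    length≡sum-ones []       = refl
    length≡sum-ones (_ ∷ zs) = cong suc (length≡sum-ones zs)

  length-filter-map-≤ : ∀ {P Q : Pred A ℓ} (P? : Decidable P) (Q? : Decidable Q) (f : A → A) →
                        (∀ x → P (f x) → Q x) → ∀ xs → length (filter P? (map f xs)) ≤ length (filter Q? xs)
  length-filter-map-≤ P? Q? f P∘f⇒Q []       = z≤n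
  length-filter-map-≤ P? Q? f P∘f⇒Q (x ∷ xs) with P? (f x) | Q? x
  ... | yes _   | yes _  = s≤s (length-filter-map-≤ P? Q? f P∘f⇒Q xs)
  ... | yes pfx | no ¬qx = contradiction (P∘f⇒Q x pfx) ¬qx
  ... | no _    | yes _  = m≤n⇒m≤1+n (length-filter-map-≤ P? Q? f P∘f⇒Q xs)
  ... | no _    | no _   = length-filter-map-≤ P? Q? f P∘f⇒Q xs

  length-filter-++ : ∀ {P : Pred A ℓ} (P? : Decidable P) xs ys →
                     length (filter P? (xs ++ ys)) ≡ length (filter P? xs) + length (filter P? ys)
  length-filter-++ P? xs ys = trans (cong length (filter-++ P? xs ys)) (length-++ (filter P? xs))

length-filter-<-≤ : ∀ {ns : List ℕ} n → Unique ns → length (filter (_<? n) ns) ≤ n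
length-filter-<-≤ {ns} n ns! = begin
  length (filter (_<? n) ns)  ≤⟨ length-mono-⊆ (Unique.filter⁺ (_<? n) ns!) (∈-upTo⁺ ∘ proj₂ ∘ ∈-filter⁻ (_<? n) {xs = ns}) ⟩
  length (upTo n)             ≡⟨ length-upTo n ⟩
  n                           ∎
  where open ≤-Reasoning

∈⇒≤sum : ∀ {n ns} → n ∈ ns → n ≤ sum ns
∈⇒≤sum {ns = m ∷ ms} (here refl)  = m≤m+n m (sum ms)
∈⇒≤sum {ns = m ∷ ms} (there n∈ms) = m≤n⇒m≤o+n m (∈⇒≤sum n∈ms)

sum-map-* : ∀ n ms → sum (map (n *_) ms) ≡ n * sum ms
sum-map-* n []       = sym (*-zeroʳ n)
sum-map-* n (m ∷ ms) = trans (cong (n * m +_) (sum-map-* n ms)) (sym (*-distribˡ-+ n m (sum ms)))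

^-distrib-* : ∀ m n o → (m * n) ^ o ≡ m ^ o * n ^ o
^-distrib-* m n zero    = refl
^-distrib-* m n (suc o) = trans (cong (m * n *_) (^-distrib-* m n o)) (interchange m n (m ^ o) (n ^ o))
  where
  interchange : ∀ a b c d → a * b * (c * d) ≡ a * c * (b * d)
  interchange = solve-∀

[m^n]^o≡[m^o]^n : ∀ m n o → (m ^ n) ^ o ≡ (m ^ o) ^ n
[m^n]^o≡[m^o]^n m n o = trans (^-*-assoc m n o) (trans (cong (m ^_) (*-comm n o)) (sym (^-*-assoc m o n)))

-- A bound x * a ≤ b * y is read as x / y ≤ b / a.
cross-≤-^ : ∀ x a b y n → x * a ≤ b * y → x ^ n * a ^ n ≤ b ^ n * y ^ n
cross-≤-^ x a b y n xa≤by = subst₂ _≤_ (^-distrib-* x a n) (^-distrib-* b y n) (^-monoˡ-≤ n xa≤by)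

cross-≤-trans : ∀ x a b y r s .{{_ : NonZero a}} → x * a ≤ b * y → b * r ≤ s * a → x * r ≤ s * y
cross-≤-trans x a b y r s xa≤by br≤sa = *-cancelʳ-≤ (x * r) (s * y) a (begin
  x * r * a      ≡⟨ e₁ x r a ⟩
  x * a * r      ≤⟨ *-monoˡ-≤ r xa≤by ⟩
  b * y * r      ≡⟨ e₂ b y r ⟩
  y * (b * r)    ≤⟨ *-monoʳ-≤ y br≤sa ⟩
  y * (s * a)    ≡⟨ e₃ y s a ⟩
  s * y * a      ∎)
  where
  open ≤-Reasoning
  e₁ : ∀ x r a → x * r * a ≡ x * a * r
  e₁ = solve-∀
  e₂ : ∀ b y r → b * y * r ≡ y * (b * r)
  e₂ = solve-∀
  e₃ : ∀ y s a → y * (s * a) ≡ s * y * a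
  e₃ = solve-∀

cross-≤-power : ∀ N X Z K k F r s .{{_ : NonZero X}} →
                N * X ^ k ≤ Z ^ k * K → Z ^ F * r ≤ s * X ^ F → N ^ F * r ^ k ≤ s ^ k * K ^ F
cross-≤-power N X Z K k F r s N*X^k≤Z^k*K Z^F*r≤s*X^F =
  cross-≤-trans (N ^ F) ((X ^ F) ^ k) ((Z ^ F) ^ k) (K ^ F) (r ^ k) (s ^ k) {{m^n≢0 (X ^ F) k {{m^n≢0 X F}}}}
    (subst₂ (λ x z → N ^ F * x ≤ z * K ^ F) ([m^n]^o≡[m^o]^n X k F) ([m^n]^o≡[m^o]^n Z k F)
      (cross-≤-^ N (X ^ k) (Z ^ k) K F N*X^k≤Z^k*K))
    (cross-≤-^ (Z ^ F) r s (X ^ F) k Z^F*r≤s*X^F)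

t^n*[t+n]≤[1+t]^n*t : ∀ t n → t ^ n * (t + n) ≤ suc t ^ n * t
t^n*[t+n]≤[1+t]^n*t t zero    = ≤-reflexive (cong (1 *_) (+-identityʳ t))
t^n*[t+n]≤[1+t]^n*t t (suc n) = begin
  t * t ^ n * (t + suc n)     ≡⟨ e₁ t (t ^ n) (t + suc n) ⟩
  t ^ n * (t * (t + suc n))   ≤⟨ *-monoʳ-≤ (t ^ n) (subst (t * (t + suc n) ≤_) (sym (e₂ t n)) (m≤m+n _ n)) ⟩
  t ^ n * ((t + n) * suc t)   ≡⟨ *-assoc (t ^ n) (t + n) (suc t) ⟨
  t ^ n * (t + n) * suc t     ≤⟨ *-monoˡ-≤ (suc t) (t^n*[t+n]≤[1+t]^n*t t n) ⟩
  suc t ^ n * t * suc t       ≡⟨ e₃ (suc t) (suc t ^ n) t ⟩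
  suc t * suc t ^ n * t       ∎
  where
  open ≤-Reasoning
  e₁ : ∀ a b c → a * b * c ≡ b * (a * c)
  e₁ = solve-∀
  e₂ : ∀ t n → (t + n) * suc t ≡ t * (t + suc n) + n
  e₂ = solve-∀
  e₃ : ∀ a b c → b * c * a ≡ a * b * c
  e₃ = solve-∀

t*t≤n⇒t*t^n≤[1+t]^n : ∀ {t n} → t * t ≤ n → t * t ^ n ≤ suc t ^ n
t*t≤n⇒t*t^n≤[1+t]^n {zero}        _     = z≤n
t*t≤n⇒t*t^n≤[1+t]^n {t@(suc _)} {n} tt≤n = *-cancelʳ-≤ (t * t ^ n) (suc t ^ n) t (begin
  t * t ^ n * t      ≡⟨ e t (t ^ n) ⟩
  t ^ n * (t * t)    ≤⟨ *-monoʳ-≤ (t ^ n) (≤-trans tt≤n (m≤n+m n t)) ⟩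
  t ^ n * (t + n)    ≤⟨ t^n*[t+n]≤[1+t]^n*t t n ⟩
  suc t ^ n * t      ∎)
  where
  open ≤-Reasoning
  e : ∀ t x → t * x * t ≡ x * (t * t)
  e = solve-∀

[1+n+d]^n*d≤[n+d]^[1+n] : ∀ n d → suc (n + d) ^ n * d ≤ (n + d) ^ suc n
[1+n+d]^n*d≤[n+d]^[1+n] zero    d = ≤-reflexive (trans (*-identityˡ d) (sym (*-identityʳ d)))
[1+n+d]^n*d≤[n+d]^[1+n] (suc n) d = begin
  s * s ^ n * d          ≡⟨ e₁ s (s ^ n) d ⟩
  s ^ n * (s * d)        ≤⟨ *-monoʳ-≤ (s ^ n) (+-mono-≤ d≤r (≤-reflexive (*-comm r d))) ⟩
  s ^ n * (suc d * r)    ≡⟨ *-assoc (s ^ n) (suc d) r ⟨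
  s ^ n * suc d * r      ≤⟨ *-monoˡ-≤ r ih ⟩
  r * r ^ n * r          ≡⟨ *-comm (r * r ^ n) r ⟩
  r * (r * r ^ n)        ∎
  where
  open ≤-Reasoning
  r = suc (n + d)
  s = suc r
  d≤r : d ≤ r
  d≤r = m≤n⇒m≤1+n (m≤n+m d n)
  ih : s ^ n * suc d ≤ r * r ^ n
  ih = subst (λ z → suc z ^ n * suc d ≤ z * z ^ n) (+-suc n d) ([1+n+d]^n*d≤[n+d]^[1+n] n (suc d))
  e₁ : ∀ a b c → a * b * c ≡ b * (a * c)
  e₁ = solve-∀

[1+t]^n*c≤[1+c]*t^n : ∀ {c n t} .{{_ : NonZero t}} → suc c * n ≤ t → suc t ^ n * c ≤ suc c * t ^ n
[1+t]^n*c≤[1+c]*t^n {c} {n} {t} [1+c]n≤t with d , refl ← m≤n⇒∃[o]m+o≡n (≤-trans (m≤m+n n (c * n)) [1+c]n≤t) =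
  *-cancelʳ-≤ (suc t ^ n * c) (suc c * t ^ n) t (begin
    suc t ^ n * c * t          ≡⟨ *-assoc (suc t ^ n) c t ⟩
    suc t ^ n * (c * t)        ≤⟨ *-monoʳ-≤ (suc t ^ n) ct≤[1+c]d ⟩
    suc t ^ n * (suc c * d)    ≡⟨ e₁ (suc t ^ n) (suc c) d ⟩
    suc c * (suc t ^ n * d)    ≤⟨ *-monoʳ-≤ (suc c) ([1+n+d]^n*d≤[n+d]^[1+n] n d) ⟩
    suc c * (t * t ^ n)        ≡⟨ e₂ (suc c) t (t ^ n) ⟩
    suc c * t ^ n * t          ∎)
  where
  open ≤-Reasoning
  cn≤d : c * n ≤ d
  cn≤d = +-cancelˡ-≤ n (c * n) d [1+c]n≤t
  ct≤[1+c]d : c * (n + d) ≤ suc c * d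
  ct≤[1+c]d = begin
    c * (n + d)      ≡⟨ *-distribˡ-+ c n d ⟩
    c * n + c * d    ≤⟨ +-monoˡ-≤ (c * d) cn≤d ⟩
    d + c * d        ∎
  e₁ : ∀ a b c → a * (b * c) ≡ b * (a * c)
  e₁ = solve-∀
  e₂ : ∀ a b c → a * (b * c) ≡ a * c * b
  e₂ = solve-∀

-- Square-free numbers and their divisors

prime≢1 : ∀ {p} → Prime p → p ≢ 1
prime≢1 p-prime refl = ¬prime[1] p-prime

noPrimeDivisor⇒≡1 : ∀ n .{{_ : NonZero n}} → (∀ p → Prime p → ¬ p ∣ n) → n ≡ 1
noPrimeDivisor⇒≡1 n noPrime with factorise n
... | record { factors = [] ; isFactorisation = n≡1 } = n≡1
... | record { factors = p ∷ _ ; isFactorisation = n≡p*m ; factorsPrime = p-prime ∷ _ } =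
  contradiction (subst (p ∣_) (sym n≡p*m) (m∣m*n _)) (noPrime p p-prime)

squareFree-∣ : ∀ {d n} → d ∣ n → SquareFree n → SquareFree d
squareFree-∣ d∣n sf p p*p∣d = sf p (∣-trans p*p∣d d∣n)

squareFree⇒nonZero : ∀ {n} → SquareFree n → NonZero n
squareFree⇒nonZero {zero}  sf with () ← sf 2 (4 ∣0)
squareFree⇒nonZero {suc n} _  = _

distinctPrimes-product-∣ : ∀ {ps n} → Unique ps → All Prime ps → All (_∣ n) ps → product ps ∣ n
distinctPrimes-product-∣ {[]}     {n} _ _ _ = 1∣ n
distinctPrimes-product-∣ {p ∷ ps} (p∉ps ∷ ps!) (p-prime ∷ ps-prime) (divides k refl ∷ ps∣k*p) =
  subst (p * product ps ∣_) (*-comm p k)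
    (*-monoʳ-∣ p (distinctPrimes-product-∣ ps! ps-prime (∣k*p⇒∣k ps-prime p∉ps ps∣k*p)))
  where
  ∣k*p⇒∣k : ∀ {rs} → All Prime rs → All (p ≢_) rs → All (_∣ k * p) rs → All (_∣ k) rs
  ∣k*p⇒∣k []                   []           []               = []
  ∣k*p⇒∣k (r-prime ∷ rs-prime) (p≢r ∷ p∉rs) (r∣k*p ∷ rs∣k*p) with euclidsLemma k p r-prime r∣k*p
  ... | inj₁ r∣k = r∣k ∷ ∣k*p⇒∣k rs-prime p∉rs rs∣k*p
  ... | inj₂ r∣p with prime⇒irreducible p-prime r∣p
  ...   | inj₁ r≡1 = contradiction r≡1 (prime≢1 r-prime)
  ...   | inj₂ r≡p = contradiction (sym r≡p) p≢r

subsetProducts : List ℕ → List ℕ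
subsetProducts []       = [ 1 ]
subsetProducts (p ∷ ps) = subsetProducts ps ++ map (p *_) (subsetProducts ps)

sum-subsetProducts : ∀ ps → sum (subsetProducts ps) ≡ product (map suc ps)
sum-subsetProducts []       = refl
sum-subsetProducts (p ∷ ps) = begin
  sum (sps ++ map (p *_) sps)     ≡⟨ sum-++ sps _ ⟩
  sum sps + sum (map (p *_) sps)  ≡⟨ cong (sum sps +_) (sum-map-* p sps) ⟩
  sum sps + p * sum sps           ≡⟨ cong (λ z → z + p * z) (sum-subsetProducts ps) ⟩
  suc p * product (map suc ps)    ∎
  where
  open ≡-Reasoning
  sps = subsetProducts ps

subsetProducts-nonZero : ∀ {ps} → All NonZero ps → All NonZero (subsetProducts ps)
subsetProducts-nonZero []                  = _ ∷ []
subsetProducts-nonZero {p ∷ _} (p≢0 ∷ ps≢0) =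
  All.++⁺ ih (All.map⁺ (All.map (λ {y} y≢0 → m*n≢0 p y {{p≢0}} {{y≢0}}) ih))
  where ih = subsetProducts-nonZero ps≢0

∈-subsetProducts : ∀ ps {d} .{{_ : NonZero d}} → SquareFree d →
                   (∀ r → Prime r → r ∣ d → r ∈ ps) → d ∈ subsetProducts ps
∈-subsetProducts [] {d} _ primes∈[] =
  subst (_∈ [ 1 ]) (sym (noPrimeDivisor⇒≡1 d (λ r r-prime r∣d → ¬Any[] (primes∈[] r r-prime r∣d)))) (here refl)
∈-subsetProducts (p ∷ ps) {d} sf primes∈p∷ps with p ∣? d
... | yes (divides k refl) = subst (_∈ subsetProducts (p ∷ ps)) (*-comm p k)
        (∈-++⁺ʳ (subsetProducts ps) (∈-map⁺ (p *_) k∈subsetProducts[ps]))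
  where
  k∣d : k ∣ k * p
  k∣d = divides p (*-comm k p)
  primes∈ps : ∀ r → Prime r → r ∣ k → r ∈ ps
  primes∈ps r r-prime r∣k with primes∈p∷ps r r-prime (∣-trans r∣k k∣d)
  ... | there r∈ps = r∈ps
  ... | here refl  = contradiction (sf r (*-monoˡ-∣ r r∣k)) (prime≢1 r-prime)
  k∈subsetProducts[ps] : k ∈ subsetProducts ps
  k∈subsetProducts[ps] = ∈-subsetProducts ps {{m*n≢0⇒m≢0 k}} (squareFree-∣ k∣d sf) primes∈ps
... | no p∤d = ∈-++⁺ˡ (∈-subsetProducts ps sf primes∈ps)
  where
  primes∈ps : ∀ r → Prime r → r ∣ d → r ∈ ps
  primes∈ps r r-prime r∣d with primes∈p∷ps r r-prime r∣d
  ... | here refl  = contradiction r∣d p∤d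
  ... | there r∈ps = r∈ps

divisors-unique : ∀ n → Unique (divisors n)
divisors-unique n = Unique.filter⁺ (_∣? n) (Unique.map⁺ suc-injective (Unique.upTo⁺ n))

∈-divisors⁻ : ∀ {n d} → d ∈ divisors n → NonZero d × d ∣ n
∈-divisors⁻ {n} d∈ with d∈suc[upTo] , d∣n ← ∈-filter⁻ (_∣? n) {xs = map suc (upTo n)} d∈
                    with _ , _ , refl ← ∈-map⁻ suc d∈suc[upTo] = _ , d∣n

n∈divisors[n] : ∀ n .{{_ : NonZero n}} → n ∈ divisors n
n∈divisors[n] (suc n) = ∈-filter⁺ (_∣? suc n) (∈-map⁺ suc (∈-upTo⁺ (n<1+n n))) ∣-refl

primeDivisors : ℕ → List ℕ
primeDivisors n = filter (λ p → prime? p ×-dec p ∣? n) (upTo (suc n))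

primeDivisors-unique : ∀ n → Unique (primeDivisors n)
primeDivisors-unique n = Unique.filter⁺ (λ p → prime? p ×-dec p ∣? n) (Unique.upTo⁺ (suc n))

∈-primeDivisors⁻ : ∀ {n p} → p ∈ primeDivisors n → Prime p × p ∣ n
∈-primeDivisors⁻ {n} = proj₂ ∘ ∈-filter⁻ (λ p → prime? p ×-dec p ∣? n) {xs = upTo (suc n)}

∈-primeDivisors⁺ : ∀ {n p} .{{_ : NonZero n}} → Prime p → p ∣ n → p ∈ primeDivisors n
∈-primeDivisors⁺ {n} p-prime p∣n =
  ∈-filter⁺ (λ p → prime? p ×-dec p ∣? n) (∈-upTo⁺ (s≤s (∣⇒≤ p∣n))) (p-prime , p∣n)

divisors⊆subsetProducts : ∀ {n} → SquareFree n → divisors n ⊆ subsetProducts (primeDivisors n)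
divisors⊆subsetProducts {n} sf d∈ with d≢0 , d∣n ← ∈-divisors⁻ d∈ =
  ∈-subsetProducts (primeDivisors n) {{d≢0}} (squareFree-∣ d∣n sf)
    (λ r r-prime r∣d → ∈-primeDivisors⁺ {{squareFree⇒nonZero sf}} r-prime (∣-trans r∣d d∣n))

n≤σ[n] : ∀ n .{{_ : NonZero n}} → n ≤ σ n
n≤σ[n] n = ∈⇒≤sum (n∈divisors[n] n)

σ≤product[1+p] : ∀ {n} → SquareFree n → σ n ≤ product (map suc (primeDivisors n))
σ≤product[1+p] {n} sf = begin
  sum (divisors n)                         ≡⟨ cong sum (map-id (divisors n)) ⟨
  sum (map id (divisors n))                ≤⟨ sum-map-mono-⊆ id (divisors-unique n) (divisors⊆subsetProducts sf) ⟩
  sum (map id (subsetProducts ps))         ≡⟨ cong sum (map-id (subsetProducts ps)) ⟩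
  sum (subsetProducts ps)                  ≡⟨ sum-subsetProducts ps ⟩
  product (map suc ps)                     ∎
  where
  open ≤-Reasoning
  ps = primeDivisors n

2^∣ps∣*product[1+p]≤3^∣ps∣*product[p] : ∀ {ps} → All (2 ≤_) ps →
                                         2 ^ length ps * product (map suc ps) ≤ 3 ^ length ps * product ps
2^∣ps∣*product[1+p]≤3^∣ps∣*product[p] []                 = ≤-refl
2^∣ps∣*product[1+p]≤3^∣ps∣*product[p] {p ∷ ps} (2≤p ∷ 2≤ps) = begin
  2 * 2 ^ length ps * (suc p * product (map suc ps))   ≡⟨ interchange 2 (2 ^ length ps) (suc p) _ ⟩
  2 * suc p * (2 ^ length ps * product (map suc ps))   ≤⟨ *-mono-≤ 2[1+p]≤3p (2^∣ps∣*product[1+p]≤3^∣ps∣*product[p] 2≤ps) ⟩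
  3 * p * (3 ^ length ps * product ps)                 ≡⟨ interchange 3 (3 ^ length ps) p (product ps) ⟨
  3 * 3 ^ length ps * (p * product ps)                 ∎
  where
  open ≤-Reasoning
  interchange : ∀ a b c d → a * b * (c * d) ≡ a * c * (b * d)
  interchange = solve-∀
  2[1+p]≤3p : 2 * suc p ≤ 3 * p
  2[1+p]≤3p = begin
    2 * suc p    ≡⟨ *-suc 2 p ⟩
    2 + 2 * p    ≤⟨ +-monoˡ-≤ (2 * p) 2≤p ⟩
    p + 2 * p    ∎

σ*2^ω≤3^ω*n : ∀ {n} → SquareFree n → σ n * 2 ^ ω n ≤ 3 ^ ω n * n
σ*2^ω≤3^ω*n {n} sf = begin
  σ n * 2 ^ ω n                          ≤⟨ *-monoˡ-≤ (2 ^ ω n) (σ≤product[1+p] sf) ⟩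
  product (map suc ps) * 2 ^ ω n         ≡⟨ *-comm _ (2 ^ ω n) ⟩
  2 ^ ω n * product (map suc ps)         ≤⟨ 2^∣ps∣*product[1+p]≤3^∣ps∣*product[p] (All.map prime⇒2≤ ps-prime) ⟩
  3 ^ ω n * product ps                   ≤⟨ *-monoʳ-≤ (3 ^ ω n) (∣⇒≤ {{n≢0}} product[ps]∣n) ⟩
  3 ^ ω n * n                            ∎
  where
  open ≤-Reasoning
  ps = primeDivisors n
  n≢0 = squareFree⇒nonZero sf
  ps-prime : All Prime ps
  ps-prime = All.tabulate (proj₁ ∘ ∈-primeDivisors⁻ {n})
  product[ps]∣n : product ps ∣ n
  product[ps]∣n = distinctPrimes-product-∣ (primeDivisors-unique n) ps-prime (All.tabulate (proj₂ ∘ ∈-primeDivisors⁻ {n}))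
  prime⇒2≤ : ∀ {p} → Prime p → 2 ≤ p
  prime⇒2≤ {p} p-prime = nonTrivial⇒n>1 p {{prime⇒nonTrivial p-prime}}

-- Rankin's trick

below? : ∀ B b Y → Decidable (λ d → d ^ B < b ^ Y)
below? B b Y d = d ^ B <? b ^ Y

countBelow : ℕ → ℕ → ℕ → List ℕ → ℕ
countBelow B b Y ds = length (filter (below? B b Y) ds)

module _ (B m b : ℕ) .{{_ : NonZero b}} {t u : ℕ} (t≤u : t ≤ u) where

  private
    U = u ^ (m * B)
    T = t ^ (m * B)
    W = U + T

    b^[m*B]*y^B≤[p*y]^B : ∀ {p} → b ^ m ≤ p → ∀ y → b ^ (m * B) * y ^ B ≤ (p * y) ^ B
    b^[m*B]*y^B≤[p*y]^B {p} b^m≤p y = begin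
      b ^ (m * B) * y ^ B    ≡⟨ cong (_* y ^ B) (^-*-assoc b m B) ⟨
      (b ^ m) ^ B * y ^ B    ≤⟨ *-monoˡ-≤ (y ^ B) (^-monoˡ-≤ B b^m≤p) ⟩
      p ^ B * y ^ B          ≡⟨ ^-distrib-* p y B ⟨
      (p * y) ^ B            ∎
      where open ≤-Reasoning

    p*y-below⇒y-below : ∀ {p Y} .{{_ : NonZero p}} → ∀ y → (p * y) ^ B < b ^ Y → y ^ B < b ^ Y
    p*y-below⇒y-below {p} y = ≤-<-trans (^-monoˡ-≤ B (m≤n*m y p))

    p*y-below⇒y-below-less : ∀ {p Z} → b ^ m ≤ p → ∀ y → (p * y) ^ B < b ^ (m * B + Z) → y ^ B < b ^ Z
    p*y-below⇒y-below-less {p} {Z} b^m≤p y [p*y]^B< = *-cancelˡ-< (b ^ (m * B)) (y ^ B) (b ^ Z) (begin-strict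
      b ^ (m * B) * y ^ B   ≤⟨ b^[m*B]*y^B≤[p*y]^B b^m≤p y ⟩
      (p * y) ^ B           <⟨ [p*y]^B< ⟩
      b ^ (m * B + Z)       ≡⟨ ^-distribˡ-+-* b (m * B) Z ⟩
      b ^ (m * B) * b ^ Z   ∎)
      where open ≤-Reasoning

    p*y-not-below : ∀ {p Y} → b ^ m ≤ p → Y ≤ m * B → ∀ {y} → NonZero y → ¬ (p * y) ^ B < b ^ Y
    p*y-not-below {p} {Y} b^m≤p Y≤mB {y} y≢0 = ≤⇒≯ (begin
      b ^ Y                 ≤⟨ ^-monoʳ-≤ b Y≤mB ⟩
      b ^ (m * B)           ≤⟨ m≤m*n (b ^ (m * B)) (y ^ B) {{m^n≢0 y B {{y≢0}}}} ⟩
      b ^ (m * B) * y ^ B   ≤⟨ b^[m*B]*y^B≤[p*y]^B b^m≤p y ⟩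
      (p * y) ^ B           ∎)
      where open ≤-Reasoning

    small-step : ∀ {c c′} Y n s → c′ ≤ c → c * t ^ Y * U ^ n ≤ 2 ^ s * u ^ Y * W ^ n →
                 (c + c′) * t ^ Y * U ^ suc n ≤ 2 ^ suc s * u ^ Y * W ^ suc n
    small-step {c} {c′} Y n s c′≤c ih = begin
      (c + c′) * t ^ Y * (U * U ^ n)       ≤⟨ *-monoˡ-≤ (U * U ^ n) (*-monoˡ-≤ (t ^ Y) (+-monoʳ-≤ c c′≤c)) ⟩
      (c + c) * t ^ Y * (U * U ^ n)        ≡⟨ e₁ c (t ^ Y) U (U ^ n) ⟩
      2 * (U * (c * t ^ Y * U ^ n))        ≤⟨ *-monoʳ-≤ 2 (*-mono-≤ (m≤m+n U T) ih) ⟩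
      2 * (W * (2 ^ s * u ^ Y * W ^ n))    ≡⟨ e₂ W (2 ^ s) (u ^ Y) (W ^ n) ⟩
      2 * 2 ^ s * u ^ Y * (W * W ^ n)      ∎
      where
      open ≤-Reasoning
      e₁ : ∀ c tY U Un → (c + c) * tY * (U * Un) ≡ 2 * (U * (c * tY * Un))
      e₁ = solve-∀
      e₂ : ∀ W S uY Wn → 2 * (W * (S * uY * Wn)) ≡ 2 * S * uY * (W * Wn)
      e₂ = solve-∀

    none-step : ∀ {c′} c Y n s → c′ ≡ 0 → c * t ^ Y * U ^ n ≤ 2 ^ s * u ^ Y * W ^ n →
                (c + c′) * t ^ Y * U ^ suc n ≤ 2 ^ s * u ^ Y * W ^ suc n
    none-step c Y n s refl ih = begin
      (c + 0) * t ^ Y * (U * U ^ n)        ≡⟨ e₁ c (t ^ Y) U (U ^ n) ⟩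
      U * (c * t ^ Y * U ^ n)              ≤⟨ *-mono-≤ (m≤m+n U T) ih ⟩
      W * (2 ^ s * u ^ Y * W ^ n)          ≡⟨ e₂ W (2 ^ s) (u ^ Y) (W ^ n) ⟩
      2 ^ s * u ^ Y * (W * W ^ n)          ∎
      where
      open ≤-Reasoning
      e₁ : ∀ c tY U Un → (c + 0) * tY * (U * Un) ≡ U * (c * tY * Un)
      e₁ = solve-∀
      e₂ : ∀ W S uY Wn → W * (S * uY * Wn) ≡ S * uY * (W * Wn)
      e₂ = solve-∀

    large-step : ∀ {c′ cZ} c Z n s → c′ ≤ cZ →
                 c * t ^ (m * B + Z) * U ^ n ≤ 2 ^ s * u ^ (m * B + Z) * W ^ n →
                 cZ * t ^ Z * U ^ n ≤ 2 ^ s * u ^ Z * W ^ n →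
                 (c + c′) * t ^ (m * B + Z) * U ^ suc n ≤ 2 ^ s * u ^ (m * B + Z) * W ^ suc n
    large-step {c′} {cZ} c Z n s c′≤cZ ih ihZ
      rewrite ^-distribˡ-+-* t (m * B) Z | ^-distribˡ-+-* u (m * B) Z = begin
      (c + c′) * (T * t ^ Z) * (U * U ^ n)  ≤⟨ *-monoˡ-≤ (U * U ^ n) (*-monoˡ-≤ (T * t ^ Z) (+-monoʳ-≤ c c′≤cZ)) ⟩
      (c + cZ) * (T * t ^ Z) * (U * U ^ n)  ≡⟨ e₁ c cZ T (t ^ Z) U (U ^ n) ⟩
      U * (c * (T * t ^ Z) * U ^ n) + T * U * (cZ * t ^ Z * U ^ n)
                                            ≤⟨ +-mono-≤ (*-monoʳ-≤ U ih) (*-monoʳ-≤ (T * U) ihZ) ⟩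
      U * (S * (U * u ^ Z) * W ^ n) + T * U * (S * u ^ Z * W ^ n)
                                            ≡⟨ e₂ S U T (u ^ Z) (W ^ n) ⟩
      S * (U * u ^ Z) * (W * W ^ n)         ∎
      where
      open ≤-Reasoning
      S = 2 ^ s
      e₁ : ∀ c cZ T tZ U Un → (c + cZ) * (T * tZ) * (U * Un) ≡ U * (c * (T * tZ) * Un) + T * U * (cZ * tZ * Un)
      e₁ = solve-∀
      e₂ : ∀ S U T uZ Wn → U * (S * (U * uZ) * Wn) + T * U * (S * uZ * Wn) ≡ S * (U * uZ) * ((U + T) * Wn)
      e₂ = solve-∀

  -- #{d ∈ subsetProducts ps : d^B < b^Y} ≤ 2^#{p ∈ ps : p < b^m} (u/t)^Y (1 + (t/u)^(mB))^|ps|,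
  -- since a prime p ≥ b^m satisfies p^B ≥ b^(mB).
  rankin : ∀ ps → All NonZero ps → ∀ Y →
    countBelow B b Y (subsetProducts ps) * t ^ Y * (u ^ (m * B)) ^ length ps
      ≤ 2 ^ length (filter (_<? b ^ m) ps) * u ^ Y * (u ^ (m * B) + t ^ (m * B)) ^ length ps
  rankin [] [] Y = *-monoˡ-≤ 1 (*-mono-≤ (length-filter (below? B b Y) [ 1 ]) (^-monoˡ-≤ Y t≤u))
  rankin (p ∷ ps) (p≢0 ∷ ps≢0) Y
    rewrite length-filter-++ (below? B b Y) (subsetProducts ps) (map (p *_) (subsetProducts ps))
    with p <? b ^ m
  ... | yes p<M rewrite filter-accept (_<? b ^ m) {xs = ps} p<M =
    small-step Y (length ps) (length (filter (_<? b ^ m) ps))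
      (length-filter-map-≤ (below? B b Y) (below? B b Y) (p *_) (p*y-below⇒y-below {Y = Y} {{p≢0}}) (subsetProducts ps))
      (rankin ps ps≢0 Y)
  ... | no p≮M rewrite filter-reject (_<? b ^ m) {xs = ps} p≮M with m * B ≤? Y
  ...   | yes mB≤Y with Z , refl ← m≤n⇒∃[o]m+o≡n mB≤Y =
    large-step (countBelow B b (m * B + Z) (subsetProducts ps)) Z (length ps) (length (filter (_<? b ^ m) ps))
      (length-filter-map-≤ (below? B b (m * B + Z)) (below? B b Z) (p *_) (p*y-below⇒y-below-less (≮⇒≥ p≮M))
        (subsetProducts ps))
      (rankin ps ps≢0 (m * B + Z)) (rankin ps ps≢0 Z)
  ...   | no mB≰Y = none-step (countBelow B b Y (subsetProducts ps)) Y (length ps) (length (filter (_<? b ^ m) ps))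
      (cong length (filter-none (below? B b Y)
        (All.map⁺ (All.map (p*y-not-below (≮⇒≥ p≮M) (≰⇒≥ mB≰Y)) (subsetProducts-nonZero ps≢0)))))
      (rankin ps ps≢0 Y)

  rankin-bound : ∀ {ps} → Unique ps → All NonZero ps →
    countBelow B b (length ps) (subsetProducts ps) * (t * U) ^ length ps ≤ (u * W) ^ length ps * 2 ^ b ^ m
  rankin-bound {ps} ps! ps≢0 = begin
    N * (t * U) ^ n          ≡⟨ cong (N *_) (^-distrib-* t U n) ⟩
    N * (t ^ n * U ^ n)      ≡⟨ *-assoc N (t ^ n) (U ^ n) ⟨
    N * t ^ n * U ^ n        ≤⟨ rankin ps ps≢0 n ⟩
    2 ^ s * u ^ n * W ^ n    ≤⟨ *-monoˡ-≤ (W ^ n) (*-monoˡ-≤ (u ^ n) (^-monoʳ-≤ 2 (length-filter-<-≤ (b ^ m) ps!))) ⟩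
    2 ^ b ^ m * u ^ n * W ^ n ≡⟨ e (2 ^ b ^ m) (u ^ n) (W ^ n) ⟩
    u ^ n * W ^ n * 2 ^ b ^ m ≡⟨ cong (_* 2 ^ b ^ m) (^-distrib-* u W n) ⟨
    (u * W) ^ n * 2 ^ b ^ m  ∎
    where
    open ≤-Reasoning
    n = length ps
    N = countBelow B b n (subsetProducts ps)
    s = length (filter (_<? b ^ m) ps)
    e : ∀ x y z → x * y * z ≡ y * z * x
    e = solve-∀

-- (1 + 1/c) (1 + (c/(1 + c))^g) ≤ (1 + 1/c)², and (1 + 1/c)^(2F) ≤ 4/3.
ratio-bound : ∀ F {c g} .{{_ : NonZero c}} → 4 * (F + F) ≤ c → c * c ≤ g →
              (suc c * (suc c ^ g + c ^ g)) ^ F * 3 ≤ 4 * (c * suc c ^ g) ^ F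
ratio-bound F {c} {g} 4[F+F]≤c cc≤g =
  cross-≤-trans (Z ^ F) ((c * c) ^ F) ((suc c * suc c) ^ F) (X ^ F) 3 4 {{m^n≢0 (c * c) F {{m*n≢0 c c}}}}
    (cross-≤-^ Z (c * c) (suc c * suc c) X F Zcc≤[1+c][1+c]X) [1+c][1+c]^F*3≤4*[cc]^F
  where
  open ≤-Reasoning
  e₁ : ∀ U T c → (U + T) * c ≡ c * T + c * U
  e₁ = solve-∀
  e₂ : ∀ a W c → a * W * (c * c) ≡ a * c * (W * c)
  e₂ = solve-∀
  e₃ : ∀ a c U → a * c * (a * U) ≡ a * a * (c * U)
  e₃ = solve-∀
  U = suc c ^ g
  T = c ^ g
  X = c * U
  Z = suc c * (U + T)
  Wc≤[1+c]U : (U + T) * c ≤ suc c * U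
  Wc≤[1+c]U = begin
    (U + T) * c      ≡⟨ e₁ U T c ⟩
    c * T + c * U    ≤⟨ +-monoˡ-≤ (c * U) (t*t≤n⇒t*t^n≤[1+t]^n cc≤g) ⟩
    suc c * U        ∎
  Zcc≤[1+c][1+c]X : Z * (c * c) ≤ suc c * suc c * X
  Zcc≤[1+c][1+c]X = begin
    suc c * (U + T) * (c * c)    ≡⟨ e₂ (suc c) (U + T) c ⟩
    suc c * c * ((U + T) * c)    ≤⟨ *-monoʳ-≤ (suc c * c) Wc≤[1+c]U ⟩
    suc c * c * (suc c * U)      ≡⟨ e₃ (suc c) c U ⟩
    suc c * suc c * (c * U)      ∎
  [x*x]^F≡x^[F+F] : ∀ x → (x * x) ^ F ≡ x ^ (F + F)
  [x*x]^F≡x^[F+F] x = trans (^-distrib-* x x F) (sym (^-distribˡ-+-* x F F))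
  [1+c][1+c]^F*3≤4*[cc]^F : (suc c * suc c) ^ F * 3 ≤ 4 * (c * c) ^ F
  [1+c][1+c]^F*3≤4*[cc]^F = subst₂ (λ x y → x * 3 ≤ 4 * y) (sym ([x*x]^F≡x^[F+F] (suc c))) (sym ([x*x]^F≡x^[F+F] c))
    ([1+t]^n*c≤[1+c]*t^n {3} {F + F} 4[F+F]≤c)

smallDivisorCount≤countBelow : ∀ A B {q} → SquareFree q →
  smallDivisorCount A B q ≤ countBelow B (2 ^ A) (ω q) (subsetProducts (primeDivisors q))
smallDivisorCount≤countBelow A B {q} sf =
  length-mono-⊆ (Unique.filter⁺ small? (divisors-unique q)) small⊆below
  where
  open ≤-Reasoning
  small? = λ d → d ^ B * sDen q ^ A <? sNum q ^ A
  small⇒below : ∀ d → d ^ B * σ q ^ A < (2 ^ ω q * q) ^ A → d ^ B < (2 ^ A) ^ ω q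
  small⇒below d small = *-cancelʳ-< (q ^ A) (d ^ B) ((2 ^ A) ^ ω q) (begin-strict
    d ^ B * q ^ A            ≤⟨ *-monoʳ-≤ (d ^ B) (^-monoˡ-≤ A (n≤σ[n] q {{squareFree⇒nonZero sf}})) ⟩
    d ^ B * σ q ^ A          <⟨ small ⟩
    (2 ^ ω q * q) ^ A        ≡⟨ ^-distrib-* (2 ^ ω q) q A ⟩
    (2 ^ ω q) ^ A * q ^ A    ≡⟨ cong (_* q ^ A) ([m^n]^o≡[m^o]^n 2 (ω q) A) ⟩
    (2 ^ A) ^ ω q * q ^ A    ∎)
  small⊆below : filter small? (divisors q) ⊆ filter (below? B (2 ^ A) (ω q)) (subsetProducts (primeDivisors q))
  small⊆below d∈ with d∈divisors , small ← ∈-filter⁻ small? {xs = divisors q} d∈ =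
    ∈-filter⁺ (below? B (2 ^ A) (ω q)) (divisors⊆subsetProducts sf d∈divisors) (small⇒below _ small)

≤[4/3]^k⇒≤s^[1+e] : ∀ {N K σ q} k e → N * 3 ^ k ≤ 4 ^ k * K → σ * 2 ^ k ≤ 3 ^ k * q →
                    N * σ ^ suc e ≤ K * (2 ^ k * q) ^ suc e
≤[4/3]^k⇒≤s^[1+e] {N} {K} {σ} {q} k e N*3^k≤4^k*K σ*2^k≤3^k*q = begin
  N * σ ^ suc e                ≤⟨ cross-≤-trans N ((3 ^ k) ^ suc e) ((4 ^ k) ^ suc e) K (σ ^ suc e) ((2 ^ k * q) ^ suc e)
                                    {{m^n≢0 (3 ^ k) (suc e) {{m^n≢0 3 k}}}} h₁ h₂ ⟩
  (2 ^ k * q) ^ suc e * K      ≡⟨ *-comm _ K ⟩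
  K * (2 ^ k * q) ^ suc e      ∎
  where
  open ≤-Reasoning
  h₁ : N * (3 ^ k) ^ suc e ≤ (4 ^ k) ^ suc e * K
  h₁ = begin
    N * (3 ^ k * (3 ^ k) ^ e)      ≡⟨ *-assoc N (3 ^ k) _ ⟨
    N * 3 ^ k * (3 ^ k) ^ e        ≤⟨ *-mono-≤ N*3^k≤4^k*K (^-monoˡ-≤ e (^-monoˡ-≤ k (n≤1+n 3))) ⟩
    4 ^ k * K * (4 ^ k) ^ e        ≡⟨ e₁ (4 ^ k) K ((4 ^ k) ^ e) ⟩
    4 ^ k * (4 ^ k) ^ e * K        ∎
    where
    e₁ : ∀ x K y → x * K * y ≡ x * y * K
    e₁ = solve-∀
  h₂ : (4 ^ k) ^ suc e * σ ^ suc e ≤ (2 ^ k * q) ^ suc e * (3 ^ k) ^ suc e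
  h₂ = cross-≤-^ (4 ^ k) σ (2 ^ k * q) (3 ^ k) (suc e) (begin
    4 ^ k * σ                ≡⟨ cong (_* σ) (^-distrib-* 2 2 k) ⟩
    2 ^ k * 2 ^ k * σ        ≡⟨ e₂ (2 ^ k) σ ⟩
    2 ^ k * (σ * 2 ^ k)      ≤⟨ *-monoʳ-≤ (2 ^ k) σ*2^k≤3^k*q ⟩
    2 ^ k * (3 ^ k * q)      ≡⟨ e₃ (2 ^ k) (3 ^ k) q ⟩
    2 ^ k * q * 3 ^ k        ∎)
    where
    e₂ : ∀ x σ → x * x * σ ≡ x * (σ * x)
    e₂ = solve-∀
    e₃ : ∀ x y q → x * (y * q) ≡ x * q * y
    e₃ = solve-∀

lemmaC1 : (a b e f : ℕ) → ∃ λ K → ∀ q → SquareFree q →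
    smallDivisorCount (suc a) (suc b) q ^ suc f * sDen q ^ suc e
    ≤ K * sNum q ^ suc e
lemmaC1 a b e f = (2 ^ M) ^ F , λ q sf →
  ≤[4/3]^k⇒≤s^[1+e] {smallDivisorCount A B q ^ F} {(2 ^ M) ^ F} {σ q} {q} (ω q) e
    (cross-≤-power (smallDivisorCount A B q) (c * U) (suc c * (U + T)) (2 ^ M) (ω q) F 3 4 {{c*U≢0}}
      (≤-trans (*-monoˡ-≤ ((c * U) ^ ω q) (smallDivisorCount≤countBelow A B sf))
               (rankin-bound B m (2 ^ A) {{m^n≢0 2 A}} (n≤1+n c) (primeDivisors-unique q) (primes≢0 q)))
      (ratio-bound F ≤-refl (m≤m*n (c * c) B)))
    (σ*2^ω≤3^ω*n sf)
  where
  A = suc a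
  B = suc b
  F = suc f
  c = 4 * (F + F)
  m = c * c
  M = (2 ^ A) ^ m
  U = suc c ^ (m * B)
  T = c ^ (m * B)
  c*U≢0 : NonZero (c * U)
  c*U≢0 = m*n≢0 c U {{_}} {{m^n≢0 (suc c) (m * B)}}
  primes≢0 : ∀ q → All NonZero (primeDivisors q)
  primes≢0 q = All.tabulate (prime⇒nonZero ∘ proj₁ ∘ ∈-primeDivisors⁻ {q})
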